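{- Let $K_{n_1,n_2}$ be the complete bipartite graph with $n_2 \ge n_1 \ge 1$. Then $\gamma(M(K_{n_1,n_2})) = n_2$.
   Context: For a finite simple graph $H$, the middle graph $M(H)$ is the graph with vertex set $V(H)\cup E(H)$ in which two elements $x,y$ are adjacent if and only if either (1) $x,y\in E(H)$ and the edges $x,y$ share a common endpoint in $H$, or (2) $x\in V(H)$, $y\in E(H)$ and $x$ is an endpoint of $y$ (or vice versa). A dominating set of a graph $H$ is a set $S\subseteq V(H)$ such that every vertex of $H$ is in $S$ or adjacent to a vertex of $S$; the domination number $\gamma(H)$ is the minimum cardinality of a dominating set of $H$. -}

module Defs where

open import Level using (0ℓ)
open import Data.Nat using (ℕ; _+_; _<_; _≥_)
open import Data.Fin using (Fin; toℕ)
open import Data.Product using (Σ; _×_; _,_)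
open import Data.Sum using (_⊎_; inj₁; inj₂)
open import Data.List using (List; length)
open import Data.List.Membership.Propositional using (_∈_)
open import Data.List.Relation.Unary.Any using (Any)
open import Relation.Binary.PropositionalEquality using (_≡_)
open import Relation.Nullary using (¬_)
open import Data.Empty using (⊥)

record Graph : Set₁ where
  field
    n     : ℕ
    Adj   : Fin n → Fin n → Set
    sym   : ∀ {u v} → Adj u v → Adj v u
    irref : ∀ {u} → ¬ Adj u u

-- Edges of G: each edge {u,v} represented exactly once as (u , v) with u < v.
Edge : Graph → Set
Edge G = Σ (Fin (Graph.n G)) λ u → Σ (Fin (Graph.n G)) λ v →
           (toℕ u < toℕ v) × Graph.Adj G u v

_endpointOf_ : {G : Graph} → Fin (Graph.n G) → Edge G → Set
x endpointOf (u , v , _) = (x ≡ u) ⊎ (x ≡ v)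

ShareEndpoint : {G : Graph} → Edge G → Edge G → Set
ShareEndpoint {G} e f = Σ (Fin (Graph.n G)) λ x → (_endpointOf_ {G} x e) × (_endpointOf_ {G} x f)

MVertex : Graph → Set
MVertex G = Fin (Graph.n G) ⊎ Edge G

MAdj : (G : Graph) → MVertex G → MVertex G → Set
MAdj G (inj₁ x) (inj₁ y) = ⊥
MAdj G (inj₁ x) (inj₂ e) = _endpointOf_ {G} x e
MAdj G (inj₂ e) (inj₁ x) = _endpointOf_ {G} x e
MAdj G (inj₂ e) (inj₂ f) = ¬ (e ≡ f) × ShareEndpoint {G} e f

-- Domination for a graph given by a vertex type and an adjacency relation.
-- A (finite) set of vertices is represented by a list.
IsDominating : {V : Set} → (V → V → Set) → List V → Set
IsDominating {V} A S = ∀ (v : V) → (v ∈ S) ⊎ Any (λ s → A s v) S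

DominationNumberIs : {V : Set} → (V → V → Set) → ℕ → Set
DominationNumberIs {V} A k =
  (Σ (List V) λ S → IsDominating A S × length S ≡ k)
  × (∀ (S : List V) → IsDominating A S → length S ≥ k)

KAdj : (n1 n2 : ℕ) → Fin (n1 + n2) → Fin (n1 + n2) → Set
KAdj n1 n2 u v = ((toℕ u < n1) × (toℕ v ≥ n1)) ⊎ ((toℕ v < n1) × (toℕ u ≥ n1))

K : ℕ → ℕ → Graph
K n1 n2 = record
  { n = n1 + n2
  ; Adj = KAdj n1 n2
  ; sym = λ { (inj₁ p) → inj₂ p ; (inj₂ p) → inj₁ p }
  ; irref = irr
  }
  where
  open import Data.Nat.Properties using (<⇒≱)
  irr : ∀ {u} → ¬ KAdj n1 n2 u u
  irr (inj₁ (a , b)) = <⇒≱ a b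
  irr (inj₂ (a , b)) = <⇒≱ a b

module Submission where

-- Proof idea.  Write A = {a₀,…,a_{n₁-1}} and B = {b₀,…,b_{n₂-1}} for the two
-- parts of K_{n₁,n₂}; every edge of K_{n₁,n₂} is a unique edge aᵢbⱼ.
--
-- Lower bound (a packing argument).  In M(K_{n₁,n₂}) the closed
-- neighbourhood of bⱼ consists of bⱼ and the edges aᵢbⱼ; these n₂ closed
-- neighbourhoods are pairwise disjoint, because an edge has exactly one
-- endpoint in B.  A dominating set meets every closed neighbourhood, so it
-- has at least n₂ elements.
--
-- Upper bound.  Pair each bⱼ with a partner a_{p(j)}, where p(j) = j for
-- j < n₁ and p(j) = 0 otherwise (n₁ ≤ n₂ makes p surjective).  The n₂ edges
-- a_{p(j)}bⱼ dominate M(K_{n₁,n₂}): aᵢ lies on the edge of index j = i, bⱼ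
-- on the edge of index j, and an edge aᵢbⱼ either is a_{p(j)}bⱼ or shares
-- its endpoint bⱼ with it.

open import Defs
open import Data.Nat using (ℕ; _+_; _≤_; _<_; _<?_)
open import Data.Nat.Properties using (≤-irrelevant; <⇒≤; <⇒≱; <-≤-trans; m≤m+n)
open import Data.Fin using (Fin; toℕ; fromℕ<; inject≤; splitAt; _↑ˡ_; _↑ʳ_; _≟_)
open import Data.Fin.Properties
  using (toℕ-↑ˡ; toℕ-↑ʳ; ↑ˡ-injective; ↑ʳ-injective; toℕ-injective;
         toℕ-fromℕ<; toℕ-inject≤; toℕ<n; splitAt⁻¹-↑ˡ; splitAt⁻¹-↑ʳ; injective⇒≤)
open import Data.Product using (Σ; _×_; _,_; proj₁; ∃₂)
open import Data.Sum using (_⊎_; inj₁; inj₂)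
open import Data.Sum.Properties using (inj₁-injective)
open import Data.List using (List; length; lookup; tabulate)
open import Data.List.Membership.Propositional using (_∈_)
open import Data.List.Relation.Unary.Any as Any using (Any)
open import Data.List.Relation.Unary.Any.Properties using (lookup-index; tabulate⁺)
open import Data.List.Properties using (length-tabulate)
open import Data.Empty using (⊥-elim)
open import Relation.Nullary using (yes; no)
open import Relation.Binary.PropositionalEquality

-- A list meeting n pairwise disjoint predicates has at least n elements:
-- the positions of the witnesses are pairwise distinct.
disjoint-witnesses-length : ∀ {a p} {A : Set a} {n : ℕ} (P : Fin n → A → Set p)
  (xs : List A) → (∀ i j {x} → P i x → P j x → i ≡ j) →
  (∀ i → Any (P i) xs) → n ≤ length xs
disjoint-witnesses-length P xs disjoint witness = injective⇒≤ position-injective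
  where
  position-injective : ∀ {i j} → Any.index (witness i) ≡ Any.index (witness j) → i ≡ j
  position-injective {i} {j} same = disjoint i j (lookup-index (witness i))
    (subst (P j) (cong (lookup xs) (sym same)) (lookup-index (witness j)))

InClosedNbhd : {V : Set} → (V → V → Set) → V → V → Set
InClosedNbhd Adj v s = (v ≡ s) ⊎ Adj s v

packing-bound : {V : Set} (Adj : V → V → Set) {n : ℕ} (t : Fin n → V) →
  (∀ i j {s} → InClosedNbhd Adj (t i) s → InClosedNbhd Adj (t j) s → i ≡ j) →
  (S : List V) → IsDominating Adj S → n ≤ length S
packing-bound Adj t disjoint S dominating =
  disjoint-witnesses-length (λ i → InClosedNbhd Adj (t i)) S disjoint meets
  where
  meets : ∀ i → Any (InClosedNbhd Adj (t i)) S
  meets i with dominating (t i)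
  ... | inj₁ member   = Any.map inj₁ member
  ... | inj₂ neighbor = Any.map inj₂ neighbor

module CompleteBipartite (n₁ n₂ : ℕ) where

  G : Graph
  G = K n₁ n₂

  a : Fin n₁ → Fin (n₁ + n₂)
  a i = i ↑ˡ n₂

  b : Fin n₂ → Fin (n₁ + n₂)
  b j = n₁ ↑ʳ j

  a-in-A : ∀ i → toℕ (a i) < n₁
  a-in-A i = subst (_< n₁) (sym (toℕ-↑ˡ i n₂)) (toℕ<n i)

  b-in-B : ∀ j → n₁ ≤ toℕ (b j)
  b-in-B j = subst (n₁ ≤_) (sym (toℕ-↑ʳ n₁ j)) (m≤m+n n₁ (toℕ j))

  data Part : Fin (n₁ + n₂) → Set where
    inA : (i : Fin n₁) → Part (a i)
    inB : (j : Fin n₂) → Part (b j)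

  part : (x : Fin (n₁ + n₂)) → Part x
  part x with splitAt n₁ x in eq
  ... | inj₁ i = subst Part (splitAt⁻¹-↑ˡ eq) (inA i)
  ... | inj₂ j = subst Part (splitAt⁻¹-↑ʳ eq) (inB j)

  ab : Fin n₁ → Fin n₂ → Edge G
  ab i j = a i , b j , <-≤-trans (a-in-A i) (b-in-B j) , inj₁ (a-in-A i , b-in-B j)

  -- An edge with endpoints aᵢ and bⱼ is the edge aᵢbⱼ (the proofs are irrelevant).
  ab-unique : ∀ i j (ordered : toℕ (a i) < toℕ (b j)) (adj : KAdj n₁ n₂ (a i) (b j)) →
    (a i , b j , ordered , adj) ≡ ab i j
  ab-unique i j ordered (inj₁ (i∈A , j∈B))
    rewrite ≤-irrelevant ordered (<-≤-trans (a-in-A i) (b-in-B j))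
          | ≤-irrelevant i∈A (a-in-A i) | ≤-irrelevant j∈B (b-in-B j) = refl
  ab-unique i j ordered (inj₂ (j∈A , _)) = ⊥-elim (<⇒≱ j∈A (b-in-B j))

  edge-view : (e : Edge G) → ∃₂ λ i j → e ≡ ab i j
  edge-view (u , v , ordered , adj) with part u | part v
  ... | inA i | inB j  = i , j , ab-unique i j ordered adj
  ... | inA i | inA i′ with adj
  ...   | inj₁ (_ , i′∈B) = ⊥-elim (<⇒≱ (a-in-A i′) i′∈B)
  ...   | inj₂ (_ , i∈B)  = ⊥-elim (<⇒≱ (a-in-A i) i∈B)
  edge-view (u , v , ordered , adj) | inB j | _ with adj
  ... | inj₁ (j∈A , _) = ⊥-elim (<⇒≱ j∈A (b-in-B j))
  ... | inj₂ (v∈A , _) = ⊥-elim (<⇒≱ (<-≤-trans v∈A (b-in-B j)) (<⇒≤ ordered))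

  b-endpoint : ∀ {i j k} → _endpointOf_ {G} (b j) (ab i k) → j ≡ k
  b-endpoint {i} {j} (inj₁ bj≡ai) =
    ⊥-elim (<⇒≱ (subst (λ x → toℕ x < n₁) (sym bj≡ai) (a-in-A i)) (b-in-B j))
  b-endpoint {k = k} (inj₂ bj≡bk) = ↑ʳ-injective n₁ _ k bj≡bk

  b-nbhds-disjoint : ∀ j j′ {s} → InClosedNbhd (MAdj G) (inj₁ (b j)) s →
    InClosedNbhd (MAdj G) (inj₁ (b j′)) s → j ≡ j′
  b-nbhds-disjoint j j′ (inj₁ refl) (inj₁ same) = ↑ʳ-injective n₁ j j′ (sym (inj₁-injective same))
  b-nbhds-disjoint j j′ {inj₂ e} (inj₂ on-e) (inj₂ on-e′) with edge-view e
  ... | i , k , refl = trans (b-endpoint on-e) (sym (b-endpoint on-e′))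

  lower-bound : (S : List (MVertex G)) → IsDominating (MAdj G) S → n₂ ≤ length S
  lower-bound = packing-bound (MAdj G) (λ j → inj₁ (b j)) b-nbhds-disjoint

module Construction (n₁ n₂ : ℕ) (n₁-pos : 1 ≤ n₁) (n₁≤n₂ : n₁ ≤ n₂) where
  open CompleteBipartite n₁ n₂

  partner : Fin n₂ → Fin n₁
  partner j with toℕ j <? n₁
  ... | yes j<n₁ = fromℕ< j<n₁
  ... | no _     = fromℕ< n₁-pos

  partner-inject : (i : Fin n₁) → partner (inject≤ i n₁≤n₂) ≡ i
  partner-inject i with toℕ (inject≤ i n₁≤n₂) <? n₁
  ... | yes lt = toℕ-injective (trans (toℕ-fromℕ< lt) (toℕ-inject≤ i n₁≤n₂))
  ... | no ge  = ⊥-elim (ge (subst (_< n₁) (sym (toℕ-inject≤ i n₁≤n₂))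
                                   (toℕ<n i)))

  matched : Fin n₂ → Edge G
  matched j = ab (partner j) j

  S₀ : List (MVertex G)
  S₀ = tabulate (λ j → inj₂ (matched j))

  dominates-edge : ∀ i j →
    (inj₂ (ab i j) ∈ S₀) ⊎ Any (λ s → MAdj G s (inj₂ (ab i j))) S₀
  dominates-edge i j with i ≟ partner j
  ... | yes refl = inj₁ (tabulate⁺ j refl)
  ... | no i≢p   = inj₂ (tabulate⁺ j (distinct , b j , inj₂ refl , inj₂ refl))
    where
    distinct : matched j ≢ ab i j
    distinct same = i≢p (sym (↑ˡ-injective n₂ _ _ (cong proj₁ same)))

  dominating : IsDominating (MAdj G) S₀
  dominating (inj₁ x) with part x
  ... | inA i = inj₂ (tabulate⁺ (inject≤ i n₁≤n₂) (inj₁ (cong a (sym (partner-inject i)))))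
  ... | inB j = inj₂ (tabulate⁺ j (inj₂ refl))
  dominating (inj₂ e) with edge-view e
  ... | i , j , refl = dominates-edge i j

  upper-bound : Σ (List (MVertex G)) λ S → IsDominating (MAdj G) S × length S ≡ n₂
  upper-bound = S₀ , dominating , length-tabulate _

proposition3p13 : (n₁ n₂ : ℕ) → 1 ≤ n₁ → n₁ ≤ n₂ →
    DominationNumberIs (MAdj (K n₁ n₂)) n₂
proposition3p13 n₁ n₂ n₁-pos n₁≤n₂ =
  Construction.upper-bound n₁ n₂ n₁-pos n₁≤n₂ , CompleteBipartite.lower-bound n₁ n₂
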